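{- Let $G$ be a connected graph of order $n\geq 3$ with maximum degree $\Delta(G)$. Then $px_k(G)\leq \Delta(G)$ for each integer $k$ with $3\leq k\leq n$.
   Context: All graphs are finite, simple, undirected and connected. An edge-coloring of a graph $G$ assigns colors to edges (adjacent edges may receive the same color). A tree in an edge-colored graph is a proper tree if any two adjacent edges of it receive different colors. For $S\subseteq V(G)$, an $S$-tree is a tree in $G$ containing all vertices of $S$. For a graph $G$ of order $n$ and an integer $k$ with $2\leq k\leq n$, an edge-coloring of $G$ is a $k$-proper coloring if for every set $S$ of $k$ vertices of $G$ there is a proper $S$-tree in $G$. The $k$-proper index $px_k(G)$ of a nontrivial connected graph $G$ is the smallest number of colors in a $k$-proper coloring of $G$. -}

module Defs where

open import Data.Nat using (ℕ; zero; suc; _+_; _≤_; _⊔_)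
open import Data.Bool using (Bool; true; false; if_then_else_)
open import Data.Fin using (Fin)
open import Data.Fin.Subset using (Subset; _∈_; ∣_∣)
open import Data.List using (List; []; _∷_; _++_; [_]; length; map; foldr; allFin)
open import Data.Nat.ListAction using (sum)
open import Data.List.Relation.Unary.Linked using (Linked)
open import Data.List.Relation.Unary.Unique.Propositional using (Unique)
open import Data.Product using (Σ; _×_; ∃; ∃-syntax)
open import Relation.Binary.PropositionalEquality using (_≡_; _≢_)
open import Relation.Nullary using (¬_)

record Graph (n : ℕ) : Set where
  field
    adj   : Fin n → Fin n → Bool
    sym   : ∀ u v → adj u v ≡ adj v u
    irref : ∀ v → adj v v ≡ false
open Graph public

data Walk {n : ℕ} (R : Fin n → Fin n → Bool) : Fin n → Fin n → Set where
  here : ∀ {u} → Walk R u u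
  step : ∀ {u v w} → R u v ≡ true → Walk R v w → Walk R u w

Connected : {n : ℕ} → Graph n → Set
Connected {n} G = ∀ (u v : Fin n) → Walk (adj G) u v

degree : {n : ℕ} → Graph n → Fin n → ℕ
degree {n} G v = sum (map (λ w → if adj G v w then 1 else 0) (allFin n))

maxDegree : {n : ℕ} → Graph n → ℕ
maxDegree {n} G = foldr _⊔_ 0 (map (degree G) (allFin n))

record Subgraph {n : ℕ} (G : Graph n) : Set where
  field
    V      : Fin n → Bool
    E      : Fin n → Fin n → Bool
    E-sym  : ∀ u v → E u v ≡ E v u
    E⊆G    : ∀ u v → E u v ≡ true → adj G u v ≡ true
    E⊆V    : ∀ u v → E u v ≡ true → V u ≡ true
open Subgraph public

HasCycle : {n : ℕ} {G : Graph n} → Subgraph G → Set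
HasCycle {n} T =
  Σ (Fin n) λ x → Σ (List (Fin n)) λ xs →
    (3 ≤ length (x ∷ xs)) × Unique (x ∷ xs) ×
    Linked (λ a b → E T a b ≡ true) (x ∷ xs ++ [ x ])

IsTree : {n : ℕ} {G : Graph n} → Subgraph G → Set
IsTree {n} T =
  (∀ (u v : Fin n) → V T u ≡ true → V T v ≡ true → Walk (E T) u v) × ¬ HasCycle T

-- Edge-colorings with colors from Fin m (only values on edges matter).
record EdgeColoring {n : ℕ} (G : Graph n) (m : ℕ) : Set where
  field
    col     : Fin n → Fin n → Fin m
    col-sym : ∀ u v → adj G u v ≡ true → col u v ≡ col v u
open EdgeColoring public

IsProper : {n m : ℕ} {G : Graph n} → EdgeColoring G m → Subgraph G → Set
IsProper {n} c T = ∀ (u v w : Fin n) → E T u v ≡ true → E T u w ≡ true → v ≢ w →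
  col c u v ≢ col c u w

IsKProper : {n m : ℕ} {G : Graph n} → ℕ → EdgeColoring G m → Set
IsKProper {n} {m} {G} k c = ∀ (S : Subset n) → ∣ S ∣ ≡ k →
  ∃[ T ] (IsTree {G = G} T × (∀ v → v ∈ S → V T v ≡ true) × IsProper c T)

pxk≤ : {n : ℕ} → Graph n → ℕ → ℕ → Set
pxk≤ G k m = Σ (EdgeColoring G m) λ c → IsKProper k c

-- A spanning tree T of G (here a breadth-first one) has maximum degree at most Δ(G), and a tree
-- of maximum degree at most Δ ≥ 1 has a proper edge colouring with Δ colours: colour it from the
-- root downwards, giving the child edges at each vertex distinct colours that also differ from
-- the colour of its parent edge. Being spanning, T is then a proper S-tree for every vertex set
-- S, so the bound holds for every k.
module Submission where

open import Defs hiding (sym)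
open import Data.Nat using (ℕ; _≤_)
open import Data.Fin using (Fin)

open import Data.Bool using (Bool; true; _∨_; if_then_else_)
open import Data.Bool.Properties using (∨-comm)
import Data.Bool.Properties as Bool
open import Data.Empty using (⊥-elim)
open import Data.Fin using (zero; suc; toℕ; _≟_)
open import Data.Fin.Properties using (any?; toℕ-fromℕ<)
open import Data.Fin.Permutation.Components using (transpose; transpose-inverse)
open import Data.List using (List; []; _∷_; _++_; [_]; foldr; tabulate)
open import Data.List.Membership.Propositional using (_∈_)
open import Data.List.Membership.Propositional.Properties using (∈-map⁺; ∈-allFin)
open import Data.List.Properties using (map-tabulate)
open import Data.List.Relation.Unary.All using (All; _∷_)
import Data.List.Relation.Unary.All as All
open import Data.List.Relation.Unary.AllPairs using (AllPairs; _∷_)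
open import Data.List.Relation.Unary.Any using (here; there)
open import Data.List.Relation.Unary.Linked using (Linked; [-]; _∷_)
import Data.List.Relation.Unary.Linked as Linked
open import Data.List.Relation.Unary.Unique.Propositional using (Unique)
open import Data.Nat using (zero; suc; _<_; _+_; _⊔_; z≤n; s≤s; NonZero)
open import Data.Nat.DivMod using (_mod_; m<n⇒m%n≡m)
open import Data.Nat.Induction using (<-wellFounded)
open import Data.Nat.ListAction using (sum)
open import Data.Nat.Properties
  using (≤-refl; <-irrefl; <-asym; <-trans; ≤-<-trans; <-≤-trans; ≮⇒≥; +-monoʳ-<; +-cancelˡ-≡;
         0≢1+n; m≤m⊔n; m≤n⇒m≤o⊔n)
open import Data.Product using (∃; ∃-syntax; _×_; _,_; proj₁; proj₂)
open import Data.Sum using (_⊎_; inj₁; inj₂)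
open import Data.Unit using (⊤; tt)
open import Induction.WellFounded using (Acc; acc)
open import Relation.Binary.Definitions using (Transitive)
open import Relation.Binary.PropositionalEquality
  using (_≡_; _≢_; refl; sym; trans; cong; subst; ≢-sym; module ≡-Reasoning)
open import Relation.Nullary using (¬_; Dec; yes; no; does; ¬?)
open import Relation.Nullary.Decidable using (_⊎-dec_; _×-dec_; dec-true)
open import Relation.Unary using (Decidable)

does-∨⇒ : ∀ {A B : Set} (a? : Dec A) (b? : Dec B) → does a? ∨ does b? ≡ true → A ⊎ B
does-∨⇒ (yes a) _       _  = inj₁ a
does-∨⇒ (no _)  (yes b) _  = inj₂ b
does-∨⇒ (no _)  (no _)  ()

indicator : Bool → ℕ
indicator b = if b then 1 else 0

count : ∀ {n} → (Fin n → Bool) → ℕ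
count f = sum (tabulate (λ i → indicator (f i)))

countBelow : ∀ {n} → (Fin n → Bool) → Fin n → ℕ
countBelow f zero    = 0
countBelow f (suc i) = indicator (f zero) + countBelow (λ j → f (suc j)) i

countBelow<count : ∀ {n} (f : Fin n → Bool) {i} → f i ≡ true → countBelow f i < count f
countBelow<count f {zero}  fi rewrite fi = s≤s z≤n
countBelow<count f {suc i} fi =
  +-monoʳ-< (indicator (f zero)) (countBelow<count (λ j → f (suc j)) fi)

countBelow-injective : ∀ {n} (f : Fin n → Bool) {i j} → f i ≡ true → f j ≡ true →
                       countBelow f i ≡ countBelow f j → i ≡ j
countBelow-injective f {zero}  {zero}  _  _  _  = refl
countBelow-injective f {zero}  {suc j} fi _  eq rewrite fi = ⊥-elim (0≢1+n eq)
countBelow-injective f {suc i} {zero}  _  fj eq rewrite fj = ⊥-elim (0≢1+n (sym eq))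
countBelow-injective f {suc i} {suc j} fi fj eq =
  cong suc (countBelow-injective (λ k → f (suc k)) fi fj (+-cancelˡ-≡ (indicator (f zero)) _ _ eq))

-- The j-th true entry of f is sent to j; `mod` only serves to make the map total.
enumerate : ∀ {n} → (Fin n → Bool) → (m : ℕ) → .{{NonZero m}} → Fin n → Fin m
enumerate f m i = countBelow f i mod m

enumerate-injective : ∀ {n} (f : Fin n → Bool) {m} .{{_ : NonZero m}} → count f ≤ m →
                      ∀ {i j} → f i ≡ true → f j ≡ true → enumerate f m i ≡ enumerate f m j → i ≡ j
enumerate-injective f {m} count≤m {i} {j} fi fj eq = countBelow-injective f fi fj (begin
  countBelow f i           ≡⟨ toℕ-enumerate fi ⟨
  toℕ (enumerate f m i)    ≡⟨ cong toℕ eq ⟩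
  toℕ (enumerate f m j)    ≡⟨ toℕ-enumerate fj ⟩
  countBelow f j           ∎)
  where
  open ≡-Reasoning
  toℕ-enumerate : ∀ {k} → f k ≡ true → toℕ (enumerate f m k) ≡ countBelow f k
  toℕ-enumerate fk = trans (toℕ-fromℕ< _) (m<n⇒m%n≡m (<-≤-trans (countBelow<count f fk) count≤m))

transpose-first : ∀ {m} (i j : Fin m) → transpose i j i ≡ j
transpose-first i j rewrite dec-true (i ≟ i) refl = refl

transpose-injective : ∀ {m} (i j : Fin m) {k l} → transpose i j k ≡ transpose i j l → k ≡ l
transpose-injective i j {k} {l} eq = begin
  k                               ≡⟨ transpose-inverse j i ⟨
  transpose j i (transpose i j k) ≡⟨ cong (transpose j i) eq ⟩
  transpose j i (transpose i j l) ≡⟨ transpose-inverse j i ⟩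
  l                               ∎
  where open ≡-Reasoning

∈⇒≤foldr-⊔ : ∀ {x xs} → x ∈ xs → x ≤ foldr _⊔_ 0 xs
∈⇒≤foldr-⊔ (here refl)  = m≤m⊔n _ _
∈⇒≤foldr-⊔ (there x∈xs) = m≤n⇒m≤o⊔n _ (∈⇒≤foldr-⊔ x∈xs)

degree≡count : ∀ {n} (G : Graph n) v → degree G v ≡ count (adj G v)
degree≡count G v = cong sum (map-tabulate (λ i → i) (λ w → indicator (adj G v w)))

degree≤maxDegree : ∀ {n} (G : Graph n) v → degree G v ≤ maxDegree G
degree≤maxDegree G v = ∈⇒≤foldr-⊔ (∈-map⁺ (degree G) (∈-allFin v))

maxDegree-positive : ∀ {n} {G : Graph n} → Connected G → ∀ {u v} → u ≢ v → 0 < maxDegree G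
maxDegree-positive {G = G} connected {u} {v} u≢v with connected u v
... | here     = ⊥-elim (u≢v refl)
... | step e _ = <-≤-trans degree-u-positive (degree≤maxDegree G u)
  where
  degree-u-positive : 0 < degree G u
  degree-u-positive =
    subst (0 <_) (sym (degree≡count G u)) (≤-<-trans z≤n (countBelow<count (adj G u) e))

_++ʷ_ : ∀ {n} {R : Fin n → Fin n → Bool} {u v w} → Walk R u v → Walk R v w → Walk R u w
here     ++ʷ q = q
step e p ++ʷ q = step e (p ++ʷ q)

reverseʷ : ∀ {n} {R : Fin n → Fin n → Bool} → (∀ a b → R a b ≡ R b a) →
           ∀ {u v} → Walk R u v → Walk R v u
reverseʷ R-sym here       = here
reverseʷ R-sym (step e w) = reverseʷ R-sym w ++ʷ step (trans (R-sym _ _) e) here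

Minimal : (ℕ → Set) → ℕ → Set
Minimal P k = P k × (∀ {j} → j < k → ¬ P j)

least : ∀ {P : ℕ → Set} → Decidable P → ∀ {m} → P m → ∃ (Minimal P)
least P? {zero} p = 0 , p , λ ()
least P? {suc m} p with P? 0
... | yes p0 = 0 , p0 , λ ()
... | no ¬p0 with least (λ k → P? (suc k)) p
...   | k , pk , below = suc k , pk , λ { {zero} _ → ¬p0 ; {suc j} (s≤s j<k) → below j<k }

NonBacktracking : ∀ {A : Set} → List A → Set
NonBacktracking (a ∷ b ∷ c ∷ cs) = a ≢ c × NonBacktracking (b ∷ c ∷ cs)
NonBacktracking _                = ⊤

nonBacktracking-∷ʳ : ∀ {A : Set} {ws : List A} {z} → AllPairs _≢_ ws → All (_≢ z) ws →
                     NonBacktracking (ws ++ [ z ])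
nonBacktracking-∷ʳ {ws = []}            _                      _         = tt
nonBacktracking-∷ʳ {ws = _ ∷ []}        _                      _         = tt
nonBacktracking-∷ʳ {ws = _ ∷ _ ∷ []}    _                      (a≢z ∷ _) = a≢z , tt
nonBacktracking-∷ʳ {ws = _ ∷ _ ∷ _ ∷ _} ((_ ∷ a≢c ∷ _) ∷ uniq) (_ ∷ ≢z)  =
  a≢c , nonBacktracking-∷ʳ uniq ≢z

cycle-nonBacktracking : ∀ {A : Set} {x y z : A} {ws} → Unique (x ∷ y ∷ z ∷ ws) →
                        NonBacktracking (x ∷ y ∷ z ∷ ws ++ [ x ])
cycle-nonBacktracking (x≢ ∷ uniq) =
  All.lookup x≢ (there (here refl)) , nonBacktracking-∷ʳ uniq (All.map ≢-sym x≢)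

Linked-last : ∀ {A : Set} {R : A → A → Set} {a z} cs → Linked R (a ∷ cs ++ [ z ]) →
              ∃[ y ] y ∈ a ∷ cs × R y z
Linked-last []       (r ∷ _) = _ , here refl , r
Linked-last (c ∷ cs) (_ ∷ l) with Linked-last cs l
... | y , y∈cs , r = y , there y∈cs , r

Linked-ends : ∀ {A : Set} {R : A → A → Set} → Transitive R →
              ∀ {a z} cs → Linked R (a ∷ cs ++ [ z ]) → R a z
Linked-ends R-trans []       (r ∷ _) = r
Linked-ends R-trans (c ∷ cs) (r ∷ l) = R-trans r (Linked-ends R-trans cs l)

record ParentMap {n : ℕ} (G : Graph n) : Set where
  field
    root         : Fin n
    parent       : Fin n → Fin n
    depth        : Fin n → ℕ
    parent-adj   : ∀ {u} → u ≢ root → adj G u (parent u) ≡ true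
    depth-parent : ∀ {u} → u ≢ root → depth (parent u) < depth u

module BreadthFirst {n : ℕ} (G : Graph n) (r : Fin n) (connected : Connected G) where

  Near : ℕ → Fin n → Set
  Near zero    u = u ≡ r
  Near (suc k) u = Near k u ⊎ ∃[ v ] adj G u v ≡ true × Near k v

  near? : ∀ k → Decidable (Near k)
  near? zero    u = u ≟ r
  near? (suc k) u = near? k u ⊎-dec any? (λ v → (adj G u v Bool.≟ true) ×-dec near? k v)

  walk⇒near : ∀ {u} → Walk (adj G) u r → ∃[ k ] Near k u
  walk⇒near here = 0 , refl
  walk⇒near (step e w) with walk⇒near w
  ... | k , near = suc k , inj₂ (_ , e , near)

  distance : Fin n → ℕ
  distance u = proj₁ (least (λ k → near? k u) (proj₂ (walk⇒near (connected u r))))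

  distance-minimal : ∀ u → Minimal (λ k → Near k u) (distance u)
  distance-minimal u = proj₂ (least (λ k → near? k u) (proj₂ (walk⇒near (connected u r))))

  distance≤ : ∀ {k v} → Near k v → distance v ≤ k
  distance≤ {v = v} near = ≮⇒≥ (λ k<d → proj₂ (distance-minimal v) k<d near)

  closer-neighbour : ∀ {u} → u ≢ r → ∃[ v ] adj G u v ≡ true × distance v < distance u
  closer-neighbour {u} u≢r with distance u | distance-minimal u
  ... | zero  | u≡r , _                 = ⊥-elim (u≢r u≡r)
  ... | suc k | inj₁ near , below       = ⊥-elim (below ≤-refl near)
  ... | suc k | inj₂ (v , e , near) , _ = v , e , s≤s (distance≤ near)

  parent : Fin n → Fin n
  parent u with u ≟ r
  ... | yes _  = u
  ... | no u≢r = proj₁ (closer-neighbour u≢r)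

  parent-closer : ∀ {u} → u ≢ r → adj G u (parent u) ≡ true × distance (parent u) < distance u
  parent-closer {u} u≢r with u ≟ r
  ... | yes u≡r = ⊥-elim (u≢r u≡r)
  ... | no u≢r′ = proj₂ (closer-neighbour u≢r′)

  parentMap : ParentMap G
  parentMap = record
    { root         = r
    ; parent       = parent
    ; depth        = distance
    ; parent-adj   = λ u≢r → proj₁ (parent-closer u≢r)
    ; depth-parent = λ u≢r → proj₂ (parent-closer u≢r)
    }

module SpanningTree {n : ℕ} {G : Graph n} (P : ParentMap G) where
  open ParentMap P

  Up : Fin n → Fin n → Set
  Up u v = u ≢ root × parent u ≡ v

  Down : Fin n → Fin n → Set
  Down u v = Up v u

  Step : Fin n → Fin n → Set
  Step u v = Up u v ⊎ Down u v

  up? : ∀ u v → Dec (Up u v)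
  up? u v = ¬? (u ≟ root) ×-dec (parent u ≟ v)

  Up-depth : ∀ {u v} → Up u v → depth v < depth u
  Up-depth (u≢r , refl) = depth-parent u≢r

  Up-functional : ∀ {u v w} → Up u v → Up u w → v ≡ w
  Up-functional (_ , refl) (_ , refl) = refl

  Up-asym : ∀ {u v} → Up u v → ¬ Up v u
  Up-asym uv vu = <-asym (Up-depth uv) (Up-depth vu)

  Step⇒adj : ∀ {u v} → Step u v → adj G u v ≡ true
  Step⇒adj         (inj₁ (u≢r , refl)) = parent-adj u≢r
  Step⇒adj {v = v} (inj₂ (v≢r , refl)) = trans (Graph.sym G (parent v) v) (parent-adj v≢r)

  treeAdj : Fin n → Fin n → Bool
  treeAdj u v = does (up? u v) ∨ does (up? v u)

  treeAdj-sym : ∀ u v → treeAdj u v ≡ treeAdj v u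
  treeAdj-sym u v = ∨-comm (does (up? u v)) (does (up? v u))

  treeAdj⇒Step : ∀ {u v} → treeAdj u v ≡ true → Step u v
  treeAdj⇒Step {u} {v} = does-∨⇒ (up? u v) (up? v u)

  Up⇒treeAdj : ∀ {u v} → Up u v → treeAdj u v ≡ true
  Up⇒treeAdj {u} {v} uv = cong (_∨ does (up? v u)) (dec-true (up? u v) uv)

  tree : Subgraph G
  tree = record
    { V     = λ _ → true
    ; E     = treeAdj
    ; E-sym = treeAdj-sym
    ; E⊆G   = λ _ _ e → Step⇒adj (treeAdj⇒Step e)
    ; E⊆V   = λ _ _ _ → refl
    }

  walkToRoot : ∀ u → Acc _<_ (depth u) → Walk treeAdj u root
  walkToRoot u (acc rs) with u ≟ root
  ... | yes refl = here
  ... | no u≢r   = step (Up⇒treeAdj (u≢r , refl)) (walkToRoot (parent u) (rs (depth-parent u≢r)))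

  tree-connected : ∀ u v → Walk treeAdj u v
  tree-connected u v =
    walkToRoot u (<-wellFounded _) ++ʷ reverseʷ treeAdj-sym (walkToRoot v (<-wellFounded _))

  descent : ∀ {a b} cs → Linked Step (a ∷ b ∷ cs) → NonBacktracking (a ∷ b ∷ cs) → Down a b →
            Linked Down (a ∷ b ∷ cs)
  descent []       _                         _         ba = ba ∷ [-]
  descent (c ∷ cs) (_ ∷ inj₁ bc ∷ _)         (a≢c , _) ba = ⊥-elim (a≢c (Up-functional ba bc))
  descent (c ∷ cs) (_ ∷ walk@(inj₂ cb ∷ _)) (_ , nb)  ba = ba ∷ descent cs walk nb cb

  endShallower⊎lastStepDown : ∀ {b c z} cs → Linked Step (b ∷ c ∷ cs ++ [ z ]) →
                              NonBacktracking (b ∷ c ∷ cs ++ [ z ]) →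
                              depth z < depth b ⊎ ∃[ y ] y ∈ c ∷ cs × Down y z
  endShallower⊎lastStepDown cs walk@(inj₂ cb ∷ _) nb =
    inj₂ (Linked-last cs (Linked.tail (descent (cs ++ [ _ ]) walk nb cb)))
  endShallower⊎lastStepDown []       (inj₁ bc ∷ inj₁ cz ∷ _) _ =
    inj₁ (<-trans (Up-depth cz) (Up-depth bc))
  endShallower⊎lastStepDown []       (inj₁ bc ∷ inj₂ zc ∷ _) _ = inj₂ (_ , here refl , zc)
  endShallower⊎lastStepDown (d ∷ cs) (inj₁ bc ∷ walk) (_ , nb)
    with endShallower⊎lastStepDown cs walk nb
  ... | inj₁ z<c           = inj₁ (<-trans z<c (Up-depth bc))
  ... | inj₂ (y , y∈ , yz) = inj₂ (y , there y∈ , yz)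

  -- Going round the cycle from x, the first step must go up (otherwise depth increases all
  -- the way back to x), and then the last step comes down into x from a vertex other than x₁,
  -- which would be a second parent of x.
  tree-acyclic : ¬ HasCycle tree
  tree-acyclic (_ , []         , s≤s ()       , _)
  tree-acyclic (_ , _ ∷ []     , s≤s (s≤s ()) , _)
  tree-acyclic (x , x₁ ∷ x₂ ∷ ys , _ , unique@(_ ∷ x₁≢ ∷ _) , cycle)
    with Linked.map treeAdj⇒Step cycle
  ... | walk@(inj₂ x₁x ∷ _) =
    <-irrefl refl (Linked-ends <-trans (x₁ ∷ x₂ ∷ ys)
      (Linked.map Up-depth (descent (x₂ ∷ ys ++ [ x ]) walk (cycle-nonBacktracking unique) x₁x)))
  ... | inj₁ xx₁ ∷ walk
    with endShallower⊎lastStepDown ys walk (proj₂ (cycle-nonBacktracking unique))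
  ...   | inj₁ x<x₁          = <-asym x<x₁ (Up-depth xx₁)
  ...   | inj₂ (y , y∈ , xy) = All.lookup x₁≢ y∈ (Up-functional xx₁ xy)

  isTree : IsTree tree
  isTree = (λ u v _ _ → tree-connected u v) , tree-acyclic

  module Colouring (D : ℕ) (count≤ : ∀ u → count (adj G u) ≤ suc D) where

    slot : Fin n → Fin n → Fin (suc D)
    slot u = enumerate (adj G u) (suc D)

    -- The tree-edge colours at u when u's parent edge has colour c: the slot numbering of u's
    -- neighbours, composed with the transposition that moves the parent's slot to c.
    atVertex : Fin n → Fin (suc D) → Fin n → Fin (suc D)
    atVertex u c v = transpose (slot u (parent u)) c (slot u v)

    atVertex-parent : ∀ u c → atVertex u c (parent u) ≡ c
    atVertex-parent u c = transpose-first (slot u (parent u)) c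

    atVertex-injective : ∀ {u c v w} → adj G u v ≡ true → adj G u w ≡ true →
                         atVertex u c v ≡ atVertex u c w → v ≡ w
    atVertex-injective {u} {c} uv uw eq =
      enumerate-injective (adj G u) (count≤ u) uv uw (transpose-injective (slot u (parent u)) c eq)

    parentEdgeColourAcc : ∀ u → Acc _<_ (depth u) → Fin (suc D)
    parentEdgeColourAcc u (acc rs) with u ≟ root
    ... | yes _  = zero
    ... | no u≢r = atVertex (parent u) (parentEdgeColourAcc (parent u) (rs (depth-parent u≢r))) u

    parentEdgeColourAcc-irrelevant : ∀ u (a b : Acc _<_ (depth u)) →
                                     parentEdgeColourAcc u a ≡ parentEdgeColourAcc u b
    parentEdgeColourAcc-irrelevant u (acc rs) (acc ss) with u ≟ root
    ... | yes _  = refl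
    ... | no u≢r = cong (λ c → atVertex (parent u) c u)
      (parentEdgeColourAcc-irrelevant (parent u) (rs (depth-parent u≢r)) (ss (depth-parent u≢r)))

    parentEdgeColour : Fin n → Fin (suc D)
    parentEdgeColour u = parentEdgeColourAcc u (<-wellFounded (depth u))

    parentEdgeColourAcc-unfold : ∀ {u} (a : Acc _<_ (depth u)) → u ≢ root →
      parentEdgeColourAcc u a ≡ atVertex (parent u) (parentEdgeColour (parent u)) u
    parentEdgeColourAcc-unfold {u} (acc rs) u≢r with u ≟ root
    ... | yes u≡r = ⊥-elim (u≢r u≡r)
    ... | no u≢r′ = cong (λ c → atVertex (parent u) c u)
      (parentEdgeColourAcc-irrelevant (parent u) (rs (depth-parent u≢r′)) (<-wellFounded _))

    edgeColour : Fin n → Fin n → Fin (suc D)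
    edgeColour u v with up? u v | up? v u
    ... | yes _ | _     = parentEdgeColour u
    ... | no _  | yes _ = parentEdgeColour v
    ... | no _  | no _  = zero

    edgeColour-sym : ∀ u v → edgeColour u v ≡ edgeColour v u
    edgeColour-sym u v with up? u v | up? v u
    ... | yes uv | yes vu = ⊥-elim (Up-asym uv vu)
    ... | yes _  | no _   = refl
    ... | no _   | yes _  = refl
    ... | no _   | no _   = refl

    edgeColour-atVertex : ∀ {u v} → Step u v → edgeColour u v ≡ atVertex u (parentEdgeColour u) v
    edgeColour-atVertex {u} {v} uv with up? u v | up? v u
    ... | yes (_ , refl) | _                = sym (atVertex-parent u _)
    ... | no _           | yes (v≢r , refl) = parentEdgeColourAcc-unfold _ v≢r
    ... | no ¬uv         | no ¬vu           with uv
    ...   | inj₁ up   = ⊥-elim (¬uv up)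
    ...   | inj₂ down = ⊥-elim (¬vu down)

    colouring : EdgeColoring G (suc D)
    colouring = record { col = edgeColour ; col-sym = λ u v _ → edgeColour-sym u v }

    tree-proper : IsProper colouring tree
    tree-proper u v w uv uw v≢w same = v≢w (atVertex-injective (Step⇒adj uv′) (Step⇒adj uw′) (begin
      atVertex u (parentEdgeColour u) v ≡⟨ edgeColour-atVertex uv′ ⟨
      edgeColour u v                    ≡⟨ same ⟩
      edgeColour u w                    ≡⟨ edgeColour-atVertex uw′ ⟩
      atVertex u (parentEdgeColour u) w ∎))
      where
      open ≡-Reasoning
      uv′ : Step u v
      uv′ = treeAdj⇒Step uv
      uw′ : Step u w
      uw′ = treeAdj⇒Step uw

    kProper : ∀ k → IsKProper k colouring
    kProper k S _ = tree , isTree , (λ _ _ → refl) , tree-proper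

pxk≤-of-degree-bound : ∀ {n} (G : Graph n) → Connected G → Fin n → ∀ {m} → 0 < m →
                       (∀ u → degree G u ≤ m) → ∀ k → pxk≤ G k m
pxk≤-of-degree-bound G connected r {suc D} _ degree≤ k = colouring , kProper k
  where
  open SpanningTree (BreadthFirst.parentMap G r connected)
  open Colouring D (λ u → subst (_≤ suc D) (degree≡count G u) (degree≤ u))

proposition3p4 : (n : ℕ) (G : Graph n) → 3 ≤ n → Connected G →
    (k : ℕ) → 3 ≤ k → k ≤ n → pxk≤ G k (maxDegree G)
proposition3p4 _ G (s≤s (s≤s (s≤s _))) connected k _ _ =
  pxk≤-of-degree-bound G connected zero
    (maxDegree-positive {G = G} connected {zero} {suc zero} λ ()) (degree≤maxDegree G) k
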